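{- For every tree $G$ on $n\geq 3$ vertices, \[ ecc(G)-\rho(G)\leq ecc(P_n)-\rho(P_n), \] where $P_n$ is the path on $n$ vertices. That is, among trees on $n\geq3$ vertices the difference $ecc-\rho$ is maximum for $P_n$.
   Context: $d(u,v)$ is the length of a shortest $u$–$v$ path. The eccentricity of a vertex is $e(v)=\max_{u\in V}d(v,u)$ and the average eccentricity is $ecc(G)=\frac1n\sum_{v\in V}e(v)$. The normalized transmission of $v$ is $\pi(v)=\frac{1}{n-1}\sum_{u\in V}d(v,u)$ and the remoteness is $\rho(G)=\max_{v\in V}\pi(v)$. -}

module Defs where

open import Data.Bool using (Bool; true; false; _∧_; if_then_else_)
open import Data.Nat using (ℕ; zero; suc; _∸_; _⊔_; _<ᵇ_; _≡ᵇ_; ∣_-_∣)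
open import Data.Fin using (Fin; toℕ)
open import Data.List using (List; map; allFin; foldr)
open import Data.Nat.ListAction using (sum)
open import Data.Bool.ListAction using (any)
open import Data.Product using (_×_; ∃-syntax)
open import Data.Integer using (+_)
open import Data.Rational using (ℚ; _/_; 0ℚ)
open import Relation.Binary.PropositionalEquality using (_≡_)

Graph : ℕ → Set
Graph n = Fin n → Fin n → Bool

IsSimple : ∀ {n} → Graph n → Set
IsSimple {n} G = (∀ (u v : Fin n) → G u v ≡ G v u) × (∀ (u : Fin n) → G u u ≡ false)

reach : ∀ {n} → Graph n → ℕ → Fin n → Fin n → Bool
reach G zero    u v = toℕ u ≡ᵇ toℕ v
reach {n} G (suc k) u v = any (λ w → reach G k u w ∧ G w v) (allFin n)

-- least b p = the least k < b with p k = true, and b if there is none.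
least : ℕ → (ℕ → Bool) → ℕ
least zero    p = zero
least (suc b) p = if p zero then zero else suc (least b (λ k → p (suc k)))

-- d(u,v): length of a shortest u–v walk (= shortest u–v path).
-- In a connected graph on n vertices this is always < n.
dist : ∀ {n} → Graph n → Fin n → Fin n → ℕ
dist {n} G u v = least n (λ k → reach G k u v)

Connected : ∀ {n} → Graph n → Set
Connected {n} G = ∀ (u v : Fin n) → ∃[ k ] (reach G k u v ≡ true)

edgeCount : ∀ {n} → Graph n → ℕ
edgeCount {n} G =
  sum (map (λ i → sum (map (λ j → if (toℕ i <ᵇ toℕ j) ∧ G i j then 1 else 0) (allFin n))) (allFin n))

IsTree : ∀ {n} → Graph n → Set
IsTree {n} G = IsSimple G × Connected G × (edgeCount G ≡ n ∸ 1)

eccentricity : ∀ {n} → Graph n → Fin n → ℕ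
eccentricity {n} G v = foldr _⊔_ 0 (map (dist G v) (allFin n))

transmission : ∀ {n} → Graph n → Fin n → ℕ
transmission {n} G v = sum (map (dist G v) (allFin n))

-- average eccentricity ecc(G) = (1/n) Σ_v e(v)   (0 for the empty graph)
ecc : ∀ {n} → Graph n → ℚ
ecc {zero}  G = 0ℚ
ecc {suc m} G = (+ sum (map (eccentricity G) (allFin (suc m)))) / suc m

-- remoteness ρ(G) = max_v π(v) = (1/(n-1)) max_v Σ_u d(v,u)   (0 for n ≤ 1)
remoteness : ∀ {n} → Graph n → ℚ
remoteness {zero}        G = 0ℚ
remoteness {suc zero}    G = 0ℚ
remoteness {suc (suc m)} G =
  (+ foldr _⊔_ 0 (map (transmission G) (allFin (suc (suc m))))) / suc m

pathGraph : (n : ℕ) → Graph n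
pathGraph n i j = ∣ toℕ i - toℕ j ∣ ≡ᵇ 1

-- Fix a diametral pair a, b of the tree and let D = d(a,b). In a tree e(v) ≤ max (d(v,a), d(v,b)),
-- and the vertices with d(v,a) + d(v,b) = D are exactly those of the a–b path, one at each depth
-- 0, …, D. Moreover (n - 1) ρ = max_v Σ_u d(v,u) ≥ Σ_v (d(v,a) + d(v,b)) / 2. Hence
-- 2 (n - 1) Σ_v e(v) - 2 n (n - 1) ρ is at most Σ_v (2 (n - 1) e(v) - n (d(v,a) + d(v,b))), to which
-- the path vertices contribute 2 (n - 1) Σ_{k ≤ D} max (k, D - k) - n D (D + 1) and each of the other
-- n - D - 1 vertices, for which d(v,a) + d(v,b) > D, at most (n - 2)(D + n) - n (n - 1). Comparing
-- with P_n, whose eccentricities sum to ⌊(3n² - 2n)/4⌋ and whose remoteness is n/2, leaves a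
-- polynomial inequality in n and D.
module Submission where

open import Defs
open import Data.Bool using (Bool; true; false; _∧_; not; if_then_else_)
open import Data.Bool.Properties using (T-≡; ∧-zeroʳ)
open import Data.Bool.ListAction using (any)
open import Data.Empty using (⊥; ⊥-elim)
open import Data.Fin using (Fin; toℕ; fromℕ<)
import Data.Fin as Fin
open import Data.Fin.Properties using (toℕ-injective; toℕ<n; toℕ-fromℕ<; pigeonhole)
import Data.Fin.Properties as Fin
import Data.Integer as ℤ
import Data.Integer.Properties as ℤ
open import Data.Integer.Tactic.RingSolver using () renaming (solve-∀ to ℤ-solve-∀)
open import Data.List using (map; allFin)
import Data.List as List
open import Data.List.Membership.Propositional using (lose)
open import Data.List.Membership.Propositional.Properties using (∈-allFin)
open import Data.List.Properties using (map-tabulate)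
open import Data.List.Relation.Unary.Any using (satisfied)
open import Data.List.Relation.Unary.Any.Properties using (any⁺; any⁻)
open import Data.Nat
  using ( ℕ; zero; suc; pred; _+_; _*_; _∸_; _⊔_; _≤_; _<_; _≤?_; _<?_; _≡ᵇ_; _<ᵇ_; z≤n; s≤s
        ; ∣_-_∣; ≢-nonZero)
open import Data.Nat.Induction using (<-wellFounded)
open import Data.Nat.Properties
open import Data.Nat.Tactic.RingSolver using (solve-∀)
open import Algebra.Properties.Semiring.Sum +-*-semiring
  using (sum; sum-syntax; ∑-distrib-+; ∑-comm; *-distribˡ-sum; sum-cong-≗; sum-replicate-zero)
open import Data.Product using (∃-syntax; _×_; _,_; proj₁; proj₂)
import Data.Product
open import Data.Rational using (_/_; _-_) renaming (_≤_ to _≤ℚ_)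
import Data.Rational as ℚ
import Data.Rational.Properties as ℚ
import Data.Rational.Unnormalised as ℚᵘ
import Data.Rational.Unnormalised.Properties as ℚᵘ
open import Data.Sum using (_⊎_; inj₁; inj₂)
import Data.Sum
open import Data.Vec.Functional using (Vector)
import Data.Vec.Functional as Vector
open import Function using (id; _∘_; Equivalence)
open import Induction.WellFounded using (Acc; acc)
open import Relation.Binary.Definitions using (tri<; tri≈; tri>)
open import Relation.Binary.PropositionalEquality
open import Relation.Nullary using (Dec; yes; no; does)
open import Relation.Nullary.Decidable using (dec-true; dec-false)

open Equivalence using (to; from)

any-witness : ∀ {A : Set} (f : A → Bool) xs → any f xs ≡ true → ∃[ x ] f x ≡ true
any-witness f xs e with satisfied (any⁻ f xs (from T-≡ e))
... | x , fx = x , to T-≡ fx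

any-allFin : ∀ {n} (f : Fin n → Bool) x → f x ≡ true → any f (allFin n) ≡ true
any-allFin f x fx = to T-≡ (any⁺ f (lose (∈-allFin x) (from T-≡ fx)))

∧-true : ∀ {b c} → b ∧ c ≡ true → b ≡ true × c ≡ true
∧-true {true} c = refl , c

<ᵇ-flip : ∀ {m n} → m ≢ n → not (m <ᵇ n) ≡ (n <ᵇ m)
<ᵇ-flip {zero} {zero} m≢n = ⊥-elim (m≢n refl)
<ᵇ-flip {zero} {suc n} _ = refl
<ᵇ-flip {suc m} {zero} _ = refl
<ᵇ-flip {suc m} {suc n} m≢n = <ᵇ-flip (m≢n ∘ cong suc)

∸-+-∸ : ∀ {k j m} → k ≤ j → j ≤ m → (m ∸ j) + (j ∸ k) ≡ m ∸ k
∸-+-∸ {k} {j} {m} k≤j j≤m = +-cancelʳ-≡ k _ _ (begin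
  (m ∸ j) + (j ∸ k) + k   ≡⟨ +-assoc (m ∸ j) _ k ⟩
  (m ∸ j) + ((j ∸ k) + k) ≡⟨ cong ((m ∸ j) +_) (m∸n+n≡m k≤j) ⟩
  (m ∸ j) + j             ≡⟨ m∸n+n≡m j≤m ⟩
  m                       ≡⟨ m∸n+n≡m (≤-trans k≤j j≤m) ⟨
  (m ∸ k) + k             ∎)
  where open ≡-Reasoning

+-cancel-double-≤ : ∀ {m n} → m + m ≤ n + n → m ≤ n
+-cancel-double-≤ {m} {n} m+m≤n+n with m ≤? n
... | yes m≤n = m≤n
... | no m≰n = ⊥-elim (<⇒≱ (+-mono-< (≰⇒> m≰n) (≰⇒> m≰n)) m+m≤n+n)

∸-∸-≤ : ∀ {a b μ c} → μ ≤ a → μ ≤ b → a + b ≤ c + (μ + μ) → (a ∸ μ) + (b ∸ μ) ≤ c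
∸-∸-≤ {a} {b} {μ} {c} μ≤a μ≤b a+b≤ = +-cancelʳ-≤ (μ + μ) _ c (begin
  (a ∸ μ) + (b ∸ μ) + (μ + μ)  ≡⟨ regroup (a ∸ μ) (b ∸ μ) μ ⟩
  (a ∸ μ + μ) + (b ∸ μ + μ)    ≡⟨ cong₂ _+_ (m∸n+n≡m μ≤a) (m∸n+n≡m μ≤b) ⟩
  a + b                        ≤⟨ a+b≤ ⟩
  c + (μ + μ)                  ∎)
  where
  open ≤-Reasoning
  regroup : ∀ x y μ → x + y + (μ + μ) ≡ (x + μ) + (y + μ)
  regroup = solve-∀

-- Walks

-- A walk of length k is a sequence of vertices indexed by ℕ; positions beyond k are junk.
record Walk {n} (G : Graph n) (k : ℕ) (u v : Fin n) : Set where
  constructor walk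
  field
    at     : ℕ → Fin n
    at-0   : at 0 ≡ u
    at-end : at k ≡ v
    step   : ∀ i → i < k → G (at i) (at (suc i)) ≡ true
open Walk

module Walks {n} (G : Graph n) where

  [] : ∀ u → Walk G 0 u u
  [] u = walk (λ _ → u) refl refl (λ _ ())

  edge : ∀ {u v} → G u v ≡ true → Walk G 1 u v
  edge {u} {v} e = walk (λ { zero → u ; (suc _) → v }) refl refl λ { zero _ → e ; (suc _) (s≤s ()) }

  take : ∀ {k u v} (W : Walk G k u v) i → i ≤ k → Walk G i u (at W i)
  take W i i≤k = walk (at W) (at-0 W) refl (λ m m<i → step W m (<-≤-trans m<i i≤k))

  drop : ∀ {k u v} (W : Walk G k u v) i → i ≤ k → Walk G (k ∸ i) (at W i) v
  drop {k} W i i≤k = walk (λ m → at W (i + m)) (cong (at W) (+-identityʳ i))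
    (trans (cong (at W) (m+[n∸m]≡n i≤k)) (at-end W))
    (λ m m< → subst (λ j → G (at W (i + m)) (at W j) ≡ true) (sym (+-suc i m))
       (step W (i + m) (subst (i + m <_) (m+[n∸m]≡n i≤k) (+-monoʳ-< i m<))))

  infixr 5 _++_
  _++_ : ∀ {k l u w v} → Walk G k u w → Walk G l w v → Walk G (k + l) u v
  _++_ {k} {l} {u} {w} {v} W V = walk vertex at-0′ at-end′ step′
    where
    vertex : ℕ → Fin n
    vertex i with i ≤? k
    ... | yes _ = at W i
    ... | no _  = at V (i ∸ k)

    early : ∀ i → i ≤ k → vertex i ≡ at W i
    early i i≤k with i ≤? k
    ... | yes _ = refl
    ... | no i≰k = ⊥-elim (i≰k i≤k)

    late : ∀ i → k ≤ i → vertex i ≡ at V (i ∸ k)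
    late i k≤i with i ≤? k
    ... | no _ = refl
    ... | yes i≤k with ≤-antisym i≤k k≤i
    ...   | refl = trans (at-end W) (trans (sym (at-0 V)) (cong (at V) (sym (n∸n≡0 i))))

    at-0′ : vertex 0 ≡ u
    at-0′ = trans (early 0 z≤n) (at-0 W)

    at-end′ : vertex (k + l) ≡ v
    at-end′ = trans (late (k + l) (m≤m+n k l)) (trans (cong (at V) (m+n∸m≡n k l)) (at-end V))

    step′ : ∀ i → i < k + l → G (vertex i) (vertex (suc i)) ≡ true
    step′ i i< = step-by (suc i ≤? k)
      where
      step-by : Dec (suc i ≤ k) → G (vertex i) (vertex (suc i)) ≡ true
      step-by (yes i<k) = subst₂ (λ x y → G x y ≡ true)
        (sym (early i (<⇒≤ i<k))) (sym (early (suc i) i<k)) (step W i i<k)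
      step-by (no i≮k) = subst₂ (λ x y → G x y ≡ true)
        (sym (late i k≤i))
        (sym (trans (late (suc i) (m≤n⇒m≤1+n k≤i)) (cong (at V) (+-∸-assoc 1 k≤i))))
        (step V (i ∸ k) (subst (i ∸ k <_) (m+n∸m≡n k l) (∸-monoˡ-< i< k≤i)))
        where
        k≤i : k ≤ i
        k≤i = ≤-pred (≰⇒> i≮k)

  infixl 5 _▷_
  _▷_ : ∀ {k u w v} → Walk G k u w → G w v ≡ true → Walk G (suc k) u v
  _▷_ {k} {u} {v = v} W e = subst (λ l → Walk G l u v) (+-comm k 1) (W ++ edge e)

  last-edge : ∀ {k u v} (W : Walk G (suc k) u v) → G (at W k) v ≡ true
  last-edge {k} W = subst (λ x → G (at W k) x ≡ true) (at-end W) (step W k ≤-refl)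

  last-edge-pred : ∀ {k u v} (W : Walk G k u v) → k ≢ 0 → G (at W (pred k)) v ≡ true
  last-edge-pred {zero} W k≢0 = ⊥-elim (k≢0 refl)
  last-edge-pred {suc k} W _ = last-edge W

  reverse : (∀ x y → G x y ≡ G y x) → ∀ {k u v} → Walk G k u v → Walk G k v u
  reverse sym-G {k} W = walk (λ i → at W (k ∸ i)) (at-end W)
    (trans (cong (at W) (n∸n≡0 k)) (at-0 W))
    (λ i i<k → trans (sym-G _ _)
       (subst (λ j → G (at W (k ∸ suc i)) (at W j) ≡ true) (sym (k∸i≡1+k∸1+i i<k))
          (step W (k ∸ suc i) (subst (_≤ k) (k∸i≡1+k∸1+i i<k) (m∸n≤m k i)))))
    where
    k∸i≡1+k∸1+i : ∀ {k i} → i < k → k ∸ i ≡ suc (k ∸ suc i)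
    k∸i≡1+k∸1+i {suc k} {zero} _ = refl
    k∸i≡1+k∸1+i {suc k} {suc i} (s≤s i<k) = k∸i≡1+k∸1+i i<k

  walk⇒reach : ∀ k {u v} → Walk G k u v → reach G k u v ≡ true
  walk⇒reach zero {u} W = subst (λ x → reach G 0 u x ≡ true) (trans (sym (at-0 W)) (at-end W))
    (to T-≡ (≡⇒≡ᵇ (toℕ u) (toℕ u) refl))
  walk⇒reach (suc k) {u} {v} W = any-allFin (λ w → reach G k u w ∧ G w v) (at W k)
    (subst (λ b → b ∧ G (at W k) v ≡ true) (sym (walk⇒reach k (take W k (n≤1+n k)))) (last-edge W))

  reach⇒walk : ∀ k {u v} → reach G k u v ≡ true → Walk G k u v
  reach⇒walk zero {u} {v} e with toℕ-injective (≡ᵇ⇒≡ (toℕ u) (toℕ v) (from T-≡ e))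
  ... | refl = [] u
  reach⇒walk (suc k) {u} {v} e with any-witness (λ w → reach G k u w ∧ G w v) (allFin n) e
  ... | w , r = reach⇒walk k (proj₁ (∧-true r)) ▷ proj₂ (∧-true r)

  -- A walk visiting n + 1 positions repeats a vertex; cutting out the cycle shortens it.
  shorten : ∀ {k u v} → n ≤ k → Walk G k u v → ∃[ k′ ] k′ < k × Walk G k′ u v
  shorten {k} {u} {v} n≤k W with pigeonhole (s≤s n≤k) (λ i → at W (toℕ i))
  ... | i , j , i<j , same = toℕ i + (k ∸ toℕ j) , shorter ,
      take W (toℕ i) (<⇒≤ (<-≤-trans i<j j≤k)) ++
      subst (λ x → Walk G (k ∸ toℕ j) x v) (sym same) (drop W (toℕ j) j≤k)
    where
    j≤k : toℕ j ≤ k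
    j≤k = ≤-pred (toℕ<n j)
    shorter : toℕ i + (k ∸ toℕ j) < k
    shorter = begin-strict
      toℕ i + (k ∸ toℕ j) <⟨ +-monoˡ-< (k ∸ toℕ j) i<j ⟩
      toℕ j + (k ∸ toℕ j) ≡⟨ m+[n∸m]≡n j≤k ⟩
      k                   ∎
      where open ≤-Reasoning

  short-walk : ∀ {k u v} → Walk G k u v → ∃[ k′ ] k′ < n × k′ ≤ k × Walk G k′ u v
  short-walk {k} W = go k W (<-wellFounded k)
    where
    go : ∀ k {u v} → Walk G k u v → Acc _<_ k → ∃[ k′ ] k′ < n × k′ ≤ k × Walk G k′ u v
    go k W (acc rec) with k <? n
    ... | yes k<n = k , k<n , ≤-refl , W
    ... | no k≮n with shorten (≮⇒≥ k≮n) W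
    ...   | k′ , k′<k , W′ with go k′ W′ (rec k′<k)
    ...     | k″ , k″<n , k″≤k′ , W″ = k″ , k″<n , ≤-trans k″≤k′ (<⇒≤ k′<k) , W″

least-spec : ∀ b (p : ℕ → Bool) {k} → k < b → p k ≡ true →
             least b p ≤ k × p (least b p) ≡ true
least-spec (suc b) p {k} k<b pk with p zero in p0
... | true = z≤n , p0
... | false with k
...   | zero = ⊥-elim (false≢true (trans (sym p0) pk))
  where
  false≢true : false ≢ true
  false≢true ()
...   | suc k = Data.Product.map₁ s≤s (least-spec b (p ∘ suc) (≤-pred k<b) pk)

module Distance {n} (G : Graph n) where
  open Walks G

  private
    least-walk : ∀ {k u v} → Walk G k u v →
                 ∃[ k′ ] k′ < n × k′ ≤ k × dist G u v ≤ k′ × reach G (dist G u v) u v ≡ true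
    least-walk {k} {u} {v} W with short-walk W
    ... | k′ , k′<n , k′≤k , W′ =
      k′ , k′<n , k′≤k , least-spec n (λ i → reach G i u v) k′<n (walk⇒reach k′ W′)

  dist-≤ : ∀ {k u v} → Walk G k u v → dist G u v ≤ k
  dist-≤ W with least-walk W
  ... | _ , _ , k′≤k , d≤k′ , _ = ≤-trans d≤k′ k′≤k

  dist-< : ∀ {k u v} → Walk G k u v → dist G u v < n
  dist-< W with least-walk W
  ... | _ , k′<n , _ , d≤k′ , _ = ≤-<-trans d≤k′ k′<n

  geodesic-from : ∀ {k u v} → Walk G k u v → Walk G (dist G u v) u v
  geodesic-from {u = u} {v} W with least-walk W
  ... | _ , _ , _ , _ , reaches = reach⇒walk (dist G u v) reaches

χ : Bool → ℕ
χ b = if b then 1 else 0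

χ-split : ∀ b c p → (p ≡ true → not b ≡ c) → χ (b ∧ p) + χ (c ∧ p) ≡ χ p
χ-split b     c false _ rewrite ∧-zeroʳ b | ∧-zeroʳ c = refl
χ-split true  c true  h rewrite sym (h refl) = refl
χ-split false c true  h rewrite sym (h refl) = refl

χ-disjoint-≤ : ∀ {b c e} → (b ≡ true → c ≡ true → ⊥) →
               (b ≡ true → e ≡ true) → (c ≡ true → e ≡ true) → χ b + χ c ≤ χ e
χ-disjoint-≤ {false} {false} _ _ _ = z≤n
χ-disjoint-≤ {true} {true} disjoint _ _ = ⊥-elim (disjoint refl refl)
χ-disjoint-≤ {true} {false} _ b⇒e _ rewrite b⇒e refl = ≤-refl
χ-disjoint-≤ {false} {true} _ _ c⇒e rewrite c⇒e refl = ≤-refl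

δ : ∀ {n} → Fin n → Fin n → ℕ
δ i j = χ (does (i Fin.≟ j))

maximum : ∀ {n} → Vector ℕ n → ℕ
maximum = Vector.foldr _⊔_ 0

foldr-map-allFin : ∀ {A : Set} (_∙_ : A → A → A) e {n} (f : Fin n → A) →
                   List.foldr _∙_ e (map f (allFin n)) ≡ Vector.foldr _∙_ e f
foldr-map-allFin _∙_ e {n} f = trans (cong (List.foldr _∙_ e) (map-tabulate id f)) (go n f)
  where
  go : ∀ n (f : Fin n → _) → List.foldr _∙_ e (List.tabulate f) ≡ Vector.foldr _∙_ e f
  go zero f = refl
  go (suc n) f = cong (f Fin.zero ∙_) (go n (f ∘ Fin.suc))

∑-mono-≤ : ∀ {n} {f g : Vector ℕ n} → (∀ i → f i ≤ g i) → sum f ≤ sum g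
∑-mono-≤ {zero} f≤g = z≤n
∑-mono-≤ {suc n} f≤g = +-mono-≤ (f≤g Fin.zero) (∑-mono-≤ (f≤g ∘ Fin.suc))

term-≤-∑ : ∀ {n} (f : Vector ℕ n) i → f i ≤ sum f
term-≤-∑ f Fin.zero = m≤m+n _ _
term-≤-∑ f (Fin.suc i) = ≤-trans (term-≤-∑ (f ∘ Fin.suc) i) (m≤n+m _ _)

∑-const : ∀ n c → ∑[ i < n ] c ≡ n * c
∑-const zero c = refl
∑-const (suc n) c = cong (c +_) (∑-const n c)

∑-δ : ∀ {n} (x : Fin n) → ∑[ i < n ] δ i x ≡ 1
∑-δ {suc n} Fin.zero = cong suc (sum-replicate-zero n)
∑-δ {suc n} (Fin.suc x) = ∑-δ x

∑-squeeze : ∀ {n} {f g : Vector ℕ n} → (∀ i → f i ≤ g i) → sum g ≤ sum f →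
            ∀ i → g i ≤ f i
∑-squeeze {suc n} f≤g ∑g≤∑f Fin.zero with m≤n⇒m<n∨m≡n (f≤g Fin.zero)
... | inj₁ f<g = ⊥-elim (<⇒≱ (+-mono-<-≤ f<g (∑-mono-≤ (f≤g ∘ Fin.suc))) ∑g≤∑f)
... | inj₂ f≡g = ≤-reflexive (sym f≡g)
∑-squeeze {suc n} {f} {g} f≤g ∑g≤∑f (Fin.suc i) =
  ∑-squeeze (f≤g ∘ Fin.suc)
    (+-cancelˡ-≤ (g Fin.zero) _ _ (≤-trans ∑g≤∑f (+-monoˡ-≤ _ (f≤g Fin.zero)))) i

∑-zero : ∀ {n} {f : Vector ℕ n} → (∀ i → f i ≡ 0) → sum f ≡ 0
∑-zero {n} f≡0 = trans (sum-cong-≗ f≡0) (sum-replicate-zero n)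

δ-refl : ∀ {n} (x : Fin n) → δ x x ≡ 1
δ-refl x = cong χ (dec-true (x Fin.≟ x) refl)

δ-≢ : ∀ {n} {x y : Fin n} → x ≢ y → δ x y ≡ 0
δ-≢ {x = x} {y} x≢y = cong χ (dec-false (x Fin.≟ y) x≢y)

∑-δ-injective : ∀ {m n} (γ : Fin m → Fin n) → (∀ {i j} → γ i ≡ γ j → i ≡ j) →
                ∀ x → ∑[ k < m ] δ x (γ k) ≤ 1
∑-δ-injective {zero} γ γ-inj x = z≤n
∑-δ-injective {suc m} γ γ-inj x with x Fin.≟ γ Fin.zero
... | yes refl = ≤-reflexive (cong suc (∑-zero {m} (λ k →
  δ-≢ (λ γ₀≡γₖ → Fin.0≢1+n (γ-inj {Fin.zero} {Fin.suc k} γ₀≡γₖ)))))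
... | no _ = ∑-δ-injective (γ ∘ Fin.suc) (Fin.suc-injective ∘ γ-inj) x

≤-maximum : ∀ {n} (f : Vector ℕ n) i → f i ≤ maximum f
≤-maximum f Fin.zero = m≤m⊔n _ _
≤-maximum f (Fin.suc i) = ≤-trans (≤-maximum (f ∘ Fin.suc) i) (m≤n⊔m _ _)

maximum-≤ : ∀ {n} {f : Vector ℕ n} {c} → (∀ i → f i ≤ c) → maximum f ≤ c
maximum-≤ {zero} f≤c = z≤n
maximum-≤ {suc n} f≤c = ⊔-lub (f≤c Fin.zero) (maximum-≤ (f≤c ∘ Fin.suc))

maximum-attained : ∀ {n} (f : Vector ℕ (suc n)) → ∃[ i ] maximum f ≡ f i
maximum-attained {zero} f = Fin.zero , ⊔-identityʳ (f Fin.zero)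
maximum-attained {suc n} f
  with maximum-attained (f ∘ Fin.suc) | ≤-total (f Fin.zero) (maximum (f ∘ Fin.suc))
... | i , eq | inj₁ ≤max = Fin.suc i , trans (m≤n⇒m⊔n≡n ≤max) eq
... | _ , _  | inj₂ ≥max = Fin.zero , m≥n⇒m⊔n≡m ≥max

rangeSum : ℕ → (ℕ → ℕ) → ℕ
rangeSum n f = ∑[ i < n ] f (toℕ i)

rangeSum-snoc : ∀ n f → rangeSum (suc n) f ≡ rangeSum n f + f n
rangeSum-snoc zero f = +-identityʳ (f 0)
rangeSum-snoc (suc n) f = trans (cong (f 0 +_) (rangeSum-snoc n (f ∘ suc))) (sym (+-assoc (f 0) _ _))

rangeSum-cong : ∀ n {f g} → (∀ i → i < n → f i ≡ g i) → rangeSum n f ≡ rangeSum n g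
rangeSum-cong n f≡g = sum-cong-≗ (λ i → f≡g (toℕ i) (toℕ<n i))

rangeSum-suc : ∀ n f → rangeSum n (suc ∘ f) ≡ n + rangeSum n f
rangeSum-suc n f = trans (∑-distrib-+ {n} (λ _ → 1) (f ∘ toℕ))
                          (cong (_+ rangeSum n f) (trans (∑-const n 1) (*-identityʳ n)))

maximum-attained₂ : ∀ {n} (f : Fin (suc n) → Fin (suc n) → ℕ) →
                    ∃[ a ] ∃[ b ] ∀ x y → f x y ≤ f a b
maximum-attained₂ f with maximum-attained (maximum ∘ f)
... | a , max≡ with maximum-attained (f a)
...   | b , maxₐ≡ = a , b , λ x y →
  ≤-trans (≤-maximum (f x) y) (≤-trans (≤-maximum (maximum ∘ f) x) (≤-reflexive (trans max≡ maxₐ≡)))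

module Metric {n} {G : Graph n} (symmetric : ∀ x y → G x y ≡ G y x) (connected : Connected G) where
  open Walks G
  open Distance G

  d : Fin n → Fin n → ℕ
  d = dist G

  geodesic : ∀ u v → Walk G (d u v) u v
  geodesic u v = geodesic-from (reach⇒walk (proj₁ (connected u v)) (proj₂ (connected u v)))

  d-triangle : ∀ u v w → d u w ≤ d u v + d v w
  d-triangle u v w = dist-≤ (geodesic u v ++ geodesic v w)

  d-sym : ∀ u v → d u v ≡ d v u
  d-sym u v = ≤-antisym (dist-≤ (reverse symmetric (geodesic v u)))
                        (dist-≤ (reverse symmetric (geodesic u v)))

  d-refl : ∀ u → d u u ≡ 0
  d-refl u = n≤0⇒n≡0 (dist-≤ ([] u))

  d≡0⇒≡ : ∀ {u v} → d u v ≡ 0 → u ≡ v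
  d≡0⇒≡ {u} {v} d≡0 = trans (sym (at-0 W)) (trans (cong (at W) (sym d≡0)) (at-end W))
    where W = geodesic u v

  d-edge : ∀ {u v} → G u v ≡ true → d u v ≤ 1
  d-edge e = dist-≤ (edge e)

  d-< : ∀ u v → d u v < n
  d-< u v = dist-< (geodesic u v)

-- n · ecc(G) and (n - 1) · ρ(G)
eccentricitySum : ∀ {n} → Graph n → ℕ
eccentricitySum {n} G = List.foldr _+_ 0 (map (eccentricity G) (allFin n))

maxTransmission : ∀ {n} → Graph n → ℕ
maxTransmission {n} G = List.foldr _⊔_ 0 (map (transmission G) (allFin n))

eccentricity≡maximum : ∀ {n} (G : Graph n) v → eccentricity G v ≡ maximum (dist G v)
eccentricity≡maximum G v = foldr-map-allFin _⊔_ 0 (dist G v)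

transmission≡sum : ∀ {n} (G : Graph n) v → transmission G v ≡ sum (dist G v)
transmission≡sum G v = foldr-map-allFin _+_ 0 (dist G v)

-- Rooted trees

module RootedTree {n} {G : Graph n} (tree : IsTree G) (root : Fin n) where

  symmetric : ∀ x y → G x y ≡ G y x
  symmetric = proj₁ (proj₁ tree)

  loopless : ∀ x → G x x ≡ false
  loopless = proj₂ (proj₁ tree)

  edge-count : edgeCount G ≡ n ∸ 1
  edge-count = proj₂ (proj₂ tree)

  open Walks G
  open Distance G
  open Metric symmetric (proj₁ (proj₂ tree)) public

  depth : Fin n → ℕ
  depth = d root

  parent : Fin n → Fin n
  parent v = at (geodesic root v) (pred (depth v))

  depth-root : depth root ≡ 0
  depth-root = d-refl root

  depth≢0 : ∀ {v} → v ≢ root → depth v ≢ 0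
  depth≢0 v≢root depth≡0 = v≢root (sym (d≡0⇒≡ depth≡0))

  private
    suc-pred-depth : ∀ {v} → v ≢ root → suc (pred (depth v)) ≡ depth v
    suc-pred-depth {v} v≢root = suc-pred (depth v) {{≢-nonZero (depth≢0 v≢root)}}

  parent-edge : ∀ {v} → v ≢ root → G (parent v) v ≡ true
  parent-edge {v} v≢root = last-edge-pred (geodesic root v) (depth≢0 v≢root)

  depth-parent : ∀ {v} → v ≢ root → suc (depth (parent v)) ≡ depth v
  depth-parent {v} v≢root = ≤-antisym shorter longer
    where
    shorter : suc (depth (parent v)) ≤ depth v
    shorter = subst (suc (depth (parent v)) ≤_) (suc-pred-depth v≢root)
      (s≤s (dist-≤ (take (geodesic root v) (pred (depth v)) pred[n]≤n)))
    longer : depth v ≤ suc (depth (parent v))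
    longer = ≤-trans (d-triangle root (parent v) v)
      (≤-trans (+-monoʳ-≤ (depth (parent v)) (d-edge (parent-edge v≢root))) (≤-reflexive (+-comm _ 1)))

  IsParent : Fin n → Fin n → Set
  IsParent x y = y ≢ root × parent y ≡ x

  IsParent⇒edge : ∀ {x y} → IsParent x y → G x y ≡ true
  IsParent⇒edge (y≢root , refl) = parent-edge y≢root

  IsParent⇒depth : ∀ {x y} → IsParent x y → suc (depth x) ≡ depth y
  IsParent⇒depth (y≢root , refl) = depth-parent y≢root

  IsParent⇒≢ : ∀ {x y} → IsParent x y → toℕ x ≢ toℕ y
  IsParent⇒≢ p x≡y with toℕ-injective x≡y
  ... | refl = 1+n≢n (IsParent⇒depth p)

  IsParent-asym : ∀ {x y} → IsParent x y → IsParent y x → ⊥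
  IsParent-asym p q = <-asym (≤-reflexive (IsParent⇒depth p)) (≤-reflexive (IsParent⇒depth q))

  isRoot : Fin n → Bool
  isRoot y = does (y Fin.≟ root)

  isParent : Fin n → Fin n → Bool
  isParent x y = not (isRoot y) ∧ does (x Fin.≟ parent y)

  isParent⇒IsParent : ∀ {x y} → isParent x y ≡ true → IsParent x y
  isParent⇒IsParent {x} {y} p with y Fin.≟ root | x Fin.≟ parent y
  ... | no y≢root | yes x≡parent = y≢root , sym x≡parent

  parent-count : ∑[ x < n ] ∑[ y < n ] χ (isParent x y) ≡ n ∸ 1
  parent-count = begin
    ∑[ x < n ] ∑[ y < n ] χ (isParent x y)  ≡⟨ ∑-comm (λ x y → χ (isParent x y)) ⟩
    ∑[ y < n ] ∑[ x < n ] χ (isParent x y)  ≡⟨ sum-cong-≗ parents-of ⟩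
    ∑[ y < n ] χ (not (isRoot y))            ≡⟨ non-roots ⟩
    n ∸ 1                                    ∎
    where
    open ≡-Reasoning
    parents-of : ∀ y → ∑[ x < n ] χ (isParent x y) ≡ χ (not (isRoot y))
    parents-of y with isRoot y
    ... | true = sum-replicate-zero n
    ... | false = ∑-δ (parent y)
    χ-not : ∀ b → χ (not b) + χ b ≡ 1
    χ-not false = refl
    χ-not true = refl
    non-roots : ∑[ y < n ] χ (not (isRoot y)) ≡ n ∸ 1
    non-roots = trans (sym (m+n∸n≡m _ 1)) (cong (_∸ 1) (begin
      (∑[ y < n ] χ (not (isRoot y))) + 1
        ≡⟨ cong ((∑[ y < n ] χ (not (isRoot y))) +_) (∑-δ root) ⟨
      (∑[ y < n ] χ (not (isRoot y))) + (∑[ y < n ] δ y root)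
        ≡⟨ ∑-distrib-+ (λ y → χ (not (isRoot y))) (λ y → δ y root) ⟨
      ∑[ y < n ] (χ (not (isRoot y)) + χ (isRoot y))
        ≡⟨ sum-cong-≗ (λ y → χ-not (isRoot y)) ⟩
      ∑[ y < n ] 1
        ≡⟨ trans (∑-const n 1) (*-identityʳ n) ⟩
      n ∎))

  private
    lt : Fin n → Fin n → Bool
    lt x y = toℕ x <ᵇ toℕ y

    ∑∑-distrib-+ : (f g : Fin n → Fin n → ℕ) → ∑[ x < n ] ∑[ y < n ] (f x y + g x y) ≡
                   (∑[ x < n ] ∑[ y < n ] f x y) + (∑[ x < n ] ∑[ y < n ] g x y)
    ∑∑-distrib-+ f g = trans (sum-cong-≗ (λ x → ∑-distrib-+ (f x) (g x)))
                             (∑-distrib-+ (λ x → ∑[ y < n ] f x y) (λ x → ∑[ y < n ] g x y))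

  parentBelow parentAbove treeEdge parentEdge : Fin n → Fin n → ℕ
  parentBelow x y = χ (lt x y ∧ isParent x y)
  parentAbove x y = χ (lt y x ∧ isParent x y)
  treeEdge x y = χ (lt x y ∧ G x y)
  parentEdge x y = parentBelow x y + parentAbove y x

  -- Each non-root vertex is counted once, through the edge to its parent.
  parentEdge-count : ∑[ x < n ] ∑[ y < n ] parentEdge x y ≡ n ∸ 1
  parentEdge-count = begin
    ∑[ x < n ] ∑[ y < n ] (parentBelow x y + parentAbove y x)
      ≡⟨ ∑∑-distrib-+ parentBelow (λ x y → parentAbove y x) ⟩
    (∑[ x < n ] ∑[ y < n ] parentBelow x y) + (∑[ x < n ] ∑[ y < n ] parentAbove y x)
      ≡⟨ cong ((∑[ x < n ] ∑[ y < n ] parentBelow x y) +_) (∑-comm (λ x y → parentAbove y x)) ⟩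
    (∑[ x < n ] ∑[ y < n ] parentBelow x y) + (∑[ x < n ] ∑[ y < n ] parentAbove x y)
      ≡⟨ ∑∑-distrib-+ parentBelow parentAbove ⟨
    ∑[ x < n ] ∑[ y < n ] (parentBelow x y + parentAbove x y)
      ≡⟨ sum-cong-≗ (λ x → sum-cong-≗ (λ y → χ-split (lt x y) (lt y x) (isParent x y)
           (λ p → <ᵇ-flip (IsParent⇒≢ (isParent⇒IsParent {x} {y} p))))) ⟩
    ∑[ x < n ] ∑[ y < n ] χ (isParent x y)
      ≡⟨ parent-count ⟩
    n ∸ 1 ∎
    where open ≡-Reasoning

  edgeCount≡∑∑ : edgeCount G ≡ ∑[ x < n ] ∑[ y < n ] treeEdge x y
  edgeCount≡∑∑ = trans (foldr-map-allFin _+_ 0 (λ x → List.foldr _+_ 0 (map (treeEdge x) (allFin n))))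
                        (sum-cong-≗ (λ x → foldr-map-allFin _+_ 0 (treeEdge x)))

  parentEdge-≤-treeEdge : ∀ x y → parentEdge x y ≤ treeEdge x y
  parentEdge-≤-treeEdge x y with lt x y
  ... | false = z≤n
  ... | true = χ-disjoint-≤
                 (λ p q → IsParent-asym (isParent⇒IsParent {x} {y} p) (isParent⇒IsParent q))
                 (λ p → IsParent⇒edge (isParent⇒IsParent {x} {y} p))
                 (λ q → trans (symmetric x y) (IsParent⇒edge (isParent⇒IsParent {y} {x} q)))

  -- The n ∸ 1 parent edges already exhaust the edges of the tree.
  treeEdge-≤-parentEdge : ∀ x y → treeEdge x y ≤ parentEdge x y
  treeEdge-≤-parentEdge x =
    ∑-squeeze (parentEdge-≤-treeEdge x)
      (∑-squeeze (λ x → ∑-mono-≤ (parentEdge-≤-treeEdge x))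
        (≤-reflexive (trans (sym edgeCount≡∑∑) (trans edge-count (sym parentEdge-count)))) x)

  ordered-edge⇒IsParent : ∀ {x y} → G x y ≡ true → toℕ x < toℕ y → IsParent x y ⊎ IsParent y x
  ordered-edge⇒IsParent {x} {y} e x<y =
    choose (subst₂ (λ b c → χ (b ∧ c) ≤ χ (b ∧ isParent x y) + χ (b ∧ isParent y x))
              (to T-≡ (<⇒<ᵇ x<y)) e (treeEdge-≤-parentEdge x y))
    where
    choose : 1 ≤ χ (isParent x y) + χ (isParent y x) → IsParent x y ⊎ IsParent y x
    choose one with isParent x y in p | isParent y x in q
    ... | true  | _    = inj₁ (isParent⇒IsParent p)
    ... | false | true = inj₂ (isParent⇒IsParent q)

  edge⇒IsParent : ∀ {x y} → G x y ≡ true → IsParent x y ⊎ IsParent y x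
  edge⇒IsParent {x} {y} e with <-cmp (toℕ x) (toℕ y)
  ... | tri< x<y _ _ = ordered-edge⇒IsParent e x<y
  ... | tri> _ _ y<x = Data.Sum.swap (ordered-edge⇒IsParent (trans (symmetric y x) e) y<x)
  ... | tri≈ _ x≡y _ with toℕ-injective x≡y
  ...   | refl = ⊥-elim (true≢false (trans (sym e) (loopless x)))
    where
    true≢false : true ≢ false
    true≢false ()

  parent^ : ℕ → Fin n → Fin n
  parent^ zero v = v
  parent^ (suc t) v = parent^ t (parent v)

  ancestor : Fin n → ℕ → Fin n
  ancestor v k = parent^ (depth v ∸ k) v

  below-root⇒≢root : ∀ {k v} → suc k ≤ depth v → v ≢ root
  below-root⇒≢root {k} k<depth refl = n≮0 (subst (suc k ≤_) depth-root k<depth)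

  private
    ≤depth-parent : ∀ {k v} → suc k ≤ depth v → k ≤ depth (parent v)
    ≤depth-parent {k} k<depth =
      ≤-pred (subst (suc k ≤_) (sym (depth-parent (below-root⇒≢root k<depth))) k<depth)

  depth-parent^ : ∀ t v → t ≤ depth v → depth (parent^ t v) + t ≡ depth v
  depth-parent^ zero v _ = +-identityʳ _
  depth-parent^ (suc t) v t<depth = begin
    depth (parent^ t (parent v)) + suc t   ≡⟨ +-suc _ t ⟩
    suc (depth (parent^ t (parent v)) + t)
      ≡⟨ cong suc (depth-parent^ t (parent v) (≤depth-parent t<depth)) ⟩
    suc (depth (parent v))                 ≡⟨ depth-parent (below-root⇒≢root t<depth) ⟩
    depth v                                ∎
    where open ≡-Reasoning

  depth-ancestor : ∀ {v k} → k ≤ depth v → depth (ancestor v k) ≡ k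
  depth-ancestor {v} {k} k≤depth = +-cancelʳ-≡ _ _ _
    (trans (depth-parent^ (depth v ∸ k) v (m∸n≤m _ k)) (sym (m+[n∸m]≡n k≤depth)))

  ancestor-self : ∀ v → ancestor v (depth v) ≡ v
  ancestor-self v = cong (λ t → parent^ t v) (n∸n≡0 (depth v))

  ancestor-parent : ∀ {v k} → k < depth v → ancestor v k ≡ ancestor (parent v) k
  ancestor-parent {v} {k} k<depth = cong (λ t → parent^ t v) (begin
    depth v ∸ k                ≡⟨ cong (_∸ k) (depth-parent (below-root⇒≢root k<depth)) ⟨
    suc (depth (parent v)) ∸ k ≡⟨ +-∸-assoc 1 (≤depth-parent k<depth) ⟩
    suc (depth (parent v) ∸ k) ∎)
    where open ≡-Reasoning

  parent^-+ : ∀ s t v → parent^ (s + t) v ≡ parent^ t (parent^ s v)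
  parent^-+ zero t v = refl
  parent^-+ (suc s) t v = parent^-+ s t (parent v)

  ancestor-ancestor : ∀ {v k j} → k ≤ j → j ≤ depth v → ancestor (ancestor v j) k ≡ ancestor v k
  ancestor-ancestor {v} {k} {j} k≤j j≤depth = begin
    parent^ (depth (ancestor v j) ∸ k) (ancestor v j)
      ≡⟨ cong (λ t → parent^ (t ∸ k) (ancestor v j)) (depth-ancestor j≤depth) ⟩
    parent^ (j ∸ k) (parent^ (depth v ∸ j) v)
      ≡⟨ parent^-+ (depth v ∸ j) (j ∸ k) v ⟨
    parent^ ((depth v ∸ j) + (j ∸ k)) v
      ≡⟨ cong (λ t → parent^ t v) (∸-+-∸ k≤j j≤depth) ⟩
    ancestor v k ∎
    where open ≡-Reasoning

  ancestors-agree-below : ∀ {u w k μ} → k ≤ μ → μ ≤ depth u → μ ≤ depth w →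
                          ancestor u μ ≡ ancestor w μ → ancestor u k ≡ ancestor w k
  ancestors-agree-below {k = k} k≤μ μ≤u μ≤w same =
    trans (sym (ancestor-ancestor k≤μ μ≤u))
          (trans (cong (λ z → ancestor z k) same) (ancestor-ancestor k≤μ μ≤w))

  climb : ∀ t v → t ≤ depth v → Walk G t v (parent^ t v)
  climb zero v _ = [] v
  climb (suc t) v t<depth =
    edge (trans (symmetric v (parent v)) (parent-edge (below-root⇒≢root t<depth))) ++
    climb t (parent v) (≤depth-parent t<depth)

  d-ancestor : ∀ v k → d v (ancestor v k) ≤ depth v ∸ k
  d-ancestor v k = dist-≤ (climb (depth v ∸ k) v (m∸n≤m _ k))

  d-via-ancestor : ∀ {u w μ} → ancestor u μ ≡ ancestor w μ →
                   d u w ≤ (depth u ∸ μ) + (depth w ∸ μ)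
  d-via-ancestor {u} {w} {μ} same = begin
    d u w                                   ≤⟨ d-triangle u (ancestor u μ) w ⟩
    d u (ancestor u μ) + d (ancestor u μ) w ≡⟨ cong (λ z → d u (ancestor u μ) + d z w) same ⟩
    d u (ancestor u μ) + d (ancestor w μ) w ≡⟨ cong (d u (ancestor u μ) +_) (d-sym (ancestor w μ) w) ⟩
    d u (ancestor u μ) + d w (ancestor w μ) ≤⟨ +-mono-≤ (d-ancestor u μ) (d-ancestor w μ) ⟩
    (depth u ∸ μ) + (depth w ∸ μ)           ∎
    where open ≤-Reasoning

  -- A walk of length m from u to w passes through a common ancestor of u and w at some
  -- depth μ, whence depth u + depth w ≤ m + 2μ.
  record Meeting (m : ℕ) (u w : Fin n) : Set where
    constructor meeting
    field
      level   : ℕ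
      level≤ˡ : level ≤ depth u
      level≤ʳ : level ≤ depth w
      common  : ancestor u level ≡ ancestor w level
      detour  : depth u + depth w ≤ m + (level + level)

  meeting-step-down : ∀ {m u x w} → Meeting m u x → IsParent x w → Meeting (suc m) u w
  meeting-step-down {m} {u} {x} {w} (meeting μ μ≤u μ≤x common detour) x↑w =
    meeting μ μ≤u (<⇒≤ μ<w) common′ (begin
      depth u + depth w       ≡⟨ cong (depth u +_) (IsParent⇒depth x↑w) ⟨
      depth u + suc (depth x) ≡⟨ +-suc (depth u) (depth x) ⟩
      suc (depth u + depth x) ≤⟨ s≤s detour ⟩
      suc m + (μ + μ)         ∎)
    where
    open ≤-Reasoning
    μ<w : μ < depth w
    μ<w = subst (μ <_) (IsParent⇒depth x↑w) (s≤s μ≤x)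
    common′ : ancestor u μ ≡ ancestor w μ
    common′ = trans common (sym (trans (ancestor-parent μ<w) (cong (λ z → ancestor z μ) (proj₂ x↑w))))

  meeting-step-up : ∀ {m u x w} → Meeting m u x → IsParent w x → Meeting (suc m) u w
  meeting-step-up {m} {u} {x} {w} (meeting μ μ≤u μ≤x common detour) w↑x with μ ≤? depth w
  ... | yes μ≤w = meeting μ μ≤u μ≤w
        (trans common (trans (ancestor-parent (≤-<-trans μ≤w w<x))
                             (cong (λ z → ancestor z μ) (proj₂ w↑x))))
        (≤-trans (+-monoʳ-≤ (depth u) (<⇒≤ w<x)) (≤-trans detour (n≤1+n _)))
    where
    w<x : depth w < depth x
    w<x = ≤-reflexive (IsParent⇒depth w↑x)
  ... | no μ≰w = meeting (depth w) (≤-trans (<⇒≤ w<μ) μ≤u) ≤-refl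
        (trans (ancestors-agree-below (<⇒≤ w<μ) μ≤u μ≤x common)
          (trans (ancestor-parent w<x) (cong (λ z → ancestor z (depth w)) (proj₂ w↑x))))
        detour′
    where
    w<x : depth w < depth x
    w<x = ≤-reflexive (IsParent⇒depth w↑x)
    w<μ : depth w < μ
    w<μ = ≰⇒> μ≰w
    μ≡1+w : μ ≡ suc (depth w)
    μ≡1+w = trans (≤-antisym μ≤x (subst (_≤ μ) (IsParent⇒depth w↑x) w<μ)) (sym (IsParent⇒depth w↑x))
    detour′ : depth u + depth w ≤ suc m + (depth w + depth w)
    detour′ = +-cancelʳ-≤ 1 _ _ (begin
      depth u + depth w + 1               ≡⟨ +-assoc (depth u) (depth w) 1 ⟩
      depth u + (depth w + 1)             ≡⟨ cong (depth u +_) (+-comm (depth w) 1) ⟩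
      depth u + suc (depth w)             ≡⟨ cong (depth u +_) (IsParent⇒depth w↑x) ⟩
      depth u + depth x                   ≤⟨ detour ⟩
      m + (μ + μ)                         ≡⟨ cong (λ z → m + (z + z)) μ≡1+w ⟩
      m + (suc (depth w) + suc (depth w)) ≡⟨ regroup m (depth w) ⟩
      suc m + (depth w + depth w) + 1     ∎)
      where
      open ≤-Reasoning
      regroup : ∀ m w → m + (suc w + suc w) ≡ suc m + (w + w) + 1
      regroup = solve-∀

  walk⇒meeting : ∀ m {u w} → Walk G m u w → Meeting m u w
  walk⇒meeting zero {u} W with trans (sym (at-0 W)) (at-end W)
  ... | refl = meeting (depth u) ≤-refl ≤-refl refl ≤-refl
  walk⇒meeting (suc m) W with edge⇒IsParent (last-edge W)
  ... | inj₁ x↑w = meeting-step-down (walk⇒meeting m (take W m (n≤1+n m))) x↑w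
  ... | inj₂ w↑x = meeting-step-up (walk⇒meeting m (take W m (n≤1+n m))) w↑x

  module Diametral (b : Fin n) (diametral : ∀ x y → d x y ≤ depth b) where

    depth+d-ancestor : ∀ {k} → k ≤ depth b → depth (ancestor b k) + d (ancestor b k) b ≡ depth b
    depth+d-ancestor {k} k≤D = ≤-antisym (begin
      depth (ancestor b k) + d (ancestor b k) b
        ≡⟨ cong₂ _+_ (depth-ancestor k≤D) (d-sym (ancestor b k) b) ⟩
      k + d b (ancestor b k)                    ≤⟨ +-monoʳ-≤ k (d-ancestor b k) ⟩
      k + (depth b ∸ k)                         ≡⟨ m+[n∸m]≡n k≤D ⟩
      depth b                                   ∎)
      (d-triangle root (ancestor b k) b)
      where open ≤-Reasoning

    geodesic-vertex : ∀ v → depth v + d v b ≡ depth b → v ≡ ancestor b (depth v)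
    geodesic-vertex v on-geodesic with walk⇒meeting (d v b) (geodesic v b)
    ... | meeting μ μ≤v μ≤b common detour =
      trans (sym (ancestor-self v))
            (trans (cong (ancestor v) v≡μ) (trans common (cong (ancestor b) (sym v≡μ))))
      where
      v≤μ : depth v ≤ μ
      v≤μ = +-cancel-double-≤ (+-cancelʳ-≤ (d v b) _ _ (begin
        depth v + depth v + d v b   ≡⟨ +-assoc (depth v) _ _ ⟩
        depth v + (depth v + d v b) ≡⟨ cong (depth v +_) on-geodesic ⟩
        depth v + depth b           ≤⟨ detour ⟩
        d v b + (μ + μ)             ≡⟨ +-comm (d v b) _ ⟩
        μ + μ + d v b               ∎))
        where open ≤-Reasoning
      v≡μ : depth v ≡ μ
      v≡μ = ≤-antisym v≤μ μ≤v

    d-≤-⊔ : ∀ v w → d v w ≤ depth v ⊔ d v b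
    d-≤-⊔ v w with walk⇒meeting (d v b) (geodesic v b) | walk⇒meeting (d w b) (geodesic w b)
    ... | meeting μ₁ μ₁≤v μ₁≤b common₁ detour₁ | meeting μ₂ μ₂≤w μ₂≤b common₂ detour₂ with μ₁ ≤? μ₂
    ... | yes μ₁≤μ₂ =
      ≤-trans (d-via-ancestor {v} {w} {μ₁} shared)
              (≤-trans (∸-∸-≤ {c = d v b} μ₁≤v μ₁≤w bound) (m≤n⊔m (depth v) (d v b)))
      where
      μ₁≤w : μ₁ ≤ depth w
      μ₁≤w = ≤-trans μ₁≤μ₂ μ₂≤w
      shared : ancestor v μ₁ ≡ ancestor w μ₁
      shared = trans common₁ (sym (ancestors-agree-below μ₁≤μ₂ μ₂≤w μ₂≤b common₂))
      bound : depth v + depth w ≤ d v b + (μ₁ + μ₁)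
      bound = ≤-trans (+-monoʳ-≤ (depth v) (diametral root w)) detour₁
    ... | no μ₁≰μ₂ =
      ≤-trans (d-via-ancestor {v} {w} {μ₂} shared)
              (≤-trans (∸-∸-≤ {c = depth v} μ₂≤v μ₂≤w bound) (m≤m⊔n (depth v) (d v b)))
      where
      μ₂≤μ₁ : μ₂ ≤ μ₁
      μ₂≤μ₁ = <⇒≤ (≰⇒> μ₁≰μ₂)
      μ₂≤v : μ₂ ≤ depth v
      μ₂≤v = ≤-trans μ₂≤μ₁ μ₁≤v
      shared : ancestor v μ₂ ≡ ancestor w μ₂
      shared = trans (ancestors-agree-below μ₂≤μ₁ μ₁≤v μ₁≤b common₁) (sym common₂)
      bound : depth v + depth w ≤ depth v + (μ₂ + μ₂)
      bound = +-monoʳ-≤ (depth v) (+-cancelʳ-≤ (depth b) _ _ (begin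
        depth w + depth b   ≤⟨ detour₂ ⟩
        d w b + (μ₂ + μ₂)   ≤⟨ +-monoˡ-≤ (μ₂ + μ₂) (diametral w b) ⟩
        depth b + (μ₂ + μ₂) ≡⟨ +-comm (depth b) _ ⟩
        μ₂ + μ₂ + depth b   ∎))
        where open ≤-Reasoning

-- The path graph

module PathGraph (n : ℕ) where
  open Walks (pathGraph n)
  open Distance (pathGraph n)

  private
    P = pathGraph n

  path-symmetric : ∀ x y → P x y ≡ P y x
  path-symmetric x y = cong (_≡ᵇ 1) (∣-∣-comm (toℕ x) (toℕ y))

  ∣-∣-≤-length : ∀ k {u w} → Walk P k u w → ∣ toℕ u - toℕ w ∣ ≤ k
  ∣-∣-≤-length zero {u} W with trans (sym (at-0 W)) (at-end W)
  ... | refl = ≤-reflexive (∣n-n∣≡0 (toℕ u))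
  ∣-∣-≤-length (suc k) {u} {w} W = begin
    ∣ toℕ u - toℕ w ∣                     ≤⟨ ∣-∣-triangle (toℕ u) (toℕ x) (toℕ w) ⟩
    ∣ toℕ u - toℕ x ∣ + ∣ toℕ x - toℕ w ∣ ≡⟨ cong (∣ toℕ u - toℕ x ∣ +_) unit-step ⟩
    ∣ toℕ u - toℕ x ∣ + 1                 ≤⟨ +-monoˡ-≤ 1 (∣-∣-≤-length k (take W k (n≤1+n k))) ⟩
    k + 1                                 ≡⟨ +-comm k 1 ⟩
    suc k                                 ∎
    where
    open ≤-Reasoning
    x = at W k
    unit-step : ∣ toℕ x - toℕ w ∣ ≡ 1
    unit-step = ≡ᵇ⇒≡ _ 1 (from T-≡ (last-edge W))

  ascending : ∀ u w → toℕ u ≤ toℕ w → Walk P (toℕ w ∸ toℕ u) u w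
  ascending u w u≤w = walk vertex at-0′ at-end′ step′
    where
    -- the i-th vertex is toℕ u + i, capped at toℕ w so that it stays in Fin n
    vertex : ℕ → Fin n
    vertex i = fromℕ< (≤-<-trans (m⊓n≤n (toℕ u + i) (toℕ w)) (toℕ<n w))
    vertex-≤ : ∀ i → toℕ u + i ≤ toℕ w → toℕ (vertex i) ≡ toℕ u + i
    vertex-≤ i ≤w = trans (toℕ-fromℕ< _) (m≤n⇒m⊓n≡m ≤w)
    at-0′ : vertex 0 ≡ u
    at-0′ = toℕ-injective (trans (vertex-≤ 0 (≤-trans (≤-reflexive (+-identityʳ _)) u≤w)) (+-identityʳ _))
    at-end′ : vertex (toℕ w ∸ toℕ u) ≡ w
    at-end′ = toℕ-injective (trans (vertex-≤ _ (≤-reflexive (m+[n∸m]≡n u≤w))) (m+[n∸m]≡n u≤w))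
    step′ : ∀ i → i < toℕ w ∸ toℕ u → P (vertex i) (vertex (suc i)) ≡ true
    step′ i i< = to T-≡ (≡⇒≡ᵇ _ 1 (begin-equality
      ∣ toℕ (vertex i) - toℕ (vertex (suc i)) ∣
        ≡⟨ cong₂ ∣_-_∣ (vertex-≤ i u+i≤w) (vertex-≤ (suc i) u+1+i≤w) ⟩
      ∣ toℕ u + i - toℕ u + suc i ∣
        ≡⟨ cong (∣ toℕ u + i -_∣) (trans (+-suc (toℕ u) i) (+-comm 1 _)) ⟩
      ∣ toℕ u + i - toℕ u + i + 1 ∣
        ≡⟨ ∣m-m+n∣≡n (toℕ u + i) 1 ⟩
      1 ∎))
      where
      open ≤-Reasoning
      u+1+i≤w : toℕ u + suc i ≤ toℕ w
      u+1+i≤w = subst (toℕ u + suc i ≤_) (m+[n∸m]≡n u≤w) (+-monoʳ-≤ (toℕ u) i<)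
      u+i≤w : toℕ u + i ≤ toℕ w
      u+i≤w = ≤-trans (+-monoʳ-≤ (toℕ u) (n≤1+n i)) u+1+i≤w

  dist-path : ∀ u w → dist P u w ≡ ∣ toℕ u - toℕ w ∣
  dist-path u w = ≤-antisym (dist-≤ straight) (∣-∣-≤-length _ (geodesic-from straight))
    where
    straight : Walk P ∣ toℕ u - toℕ w ∣ u w
    straight with ≤-total (toℕ u) (toℕ w)
    ... | inj₁ u≤w = subst (λ k → Walk P k u w) (sym (m≤n⇒∣m-n∣≡n∸m u≤w)) (ascending u w u≤w)
    ... | inj₂ w≤u = subst (λ k → Walk P k u w) (sym (m≤n⇒∣n-m∣≡n∸m w≤u))
                       (reverse path-symmetric (ascending w u w≤u))

-- The eccentricities of the vertices 0, 1, …, m - 1 of the path on m vertices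
pathEccentricity : ℕ → ℕ → ℕ
pathEccentricity m i = i ⊔ (pred m ∸ i)

pathEccentricitySum : ℕ → ℕ
pathEccentricitySum m = rangeSum m (pathEccentricity m)

pathEccentricitySum-step : ∀ m → pathEccentricitySum (suc (suc m)) ≡ pathEccentricitySum m + (3 * m + 2)
pathEccentricitySum-step m = begin
  suc m + rangeSum (suc m) inner
    ≡⟨ cong (suc m +_) (rangeSum-snoc m inner) ⟩
  suc m + (rangeSum m inner + (suc m ⊔ (m ∸ m)))
    ≡⟨ cong (λ x → suc m + (rangeSum m inner + (suc m ⊔ x))) (n∸n≡0 m) ⟩
  suc m + (rangeSum m inner + suc m)
    ≡⟨ cong (λ x → suc m + (x + suc m)) (rangeSum-cong m inner≡) ⟩
  suc m + (rangeSum m (suc ∘ pathEccentricity m) + suc m)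
    ≡⟨ cong (λ x → suc m + (x + suc m)) (rangeSum-suc m (pathEccentricity m)) ⟩
  suc m + ((m + pathEccentricitySum m) + suc m)
    ≡⟨ regroup m (pathEccentricitySum m) ⟩
  pathEccentricitySum m + (3 * m + 2) ∎
  where
  open ≡-Reasoning
  inner : ℕ → ℕ
  inner = pathEccentricity (suc (suc m)) ∘ suc
  ∸-pred : ∀ {m i} → i < m → m ∸ i ≡ suc (pred m ∸ i)
  ∸-pred {suc m} (s≤s i≤m) = +-∸-assoc 1 i≤m
  inner≡ : ∀ i → i < m → inner i ≡ suc (pathEccentricity m i)
  inner≡ i i<m = cong (suc i ⊔_) (∸-pred i<m)
  regroup : ∀ m x → suc m + ((m + x) + suc m) ≡ x + (3 * m + 2)
  regroup = solve-∀

-- 4 · pathEccentricitySum m is 3m² - 2m for even m and 3m² - 2m - 1 for odd m.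
pathEccentricitySum-bounds : ∀ m → 4 * pathEccentricitySum m + 2 * m ≤ 3 * (m * m)
                                 × 3 * (m * m) ≤ 4 * pathEccentricitySum m + 2 * m + 1
pathEccentricitySum-bounds zero = z≤n , z≤n
pathEccentricitySum-bounds (suc zero) = s≤s (s≤s z≤n) , ≤-refl
pathEccentricitySum-bounds (suc (suc m)) with pathEccentricitySum-bounds m
... | lower , upper = lower′ , upper′
  where
  open ≤-Reasoning
  M = pathEccentricitySum m
  shift : ∀ m x → 4 * (x + (3 * m + 2)) + 2 * suc (suc m) ≡ 4 * x + 2 * m + (12 * m + 12)
  shift = solve-∀
  square : ∀ m → 3 * (suc (suc m) * suc (suc m)) ≡ 3 * (m * m) + (12 * m + 12)
  square = solve-∀
  lower′ : 4 * pathEccentricitySum (suc (suc m)) + 2 * suc (suc m) ≤ 3 * (suc (suc m) * suc (suc m))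
  lower′ = begin
    4 * pathEccentricitySum (suc (suc m)) + 2 * suc (suc m)
      ≡⟨ cong (λ x → 4 * x + 2 * suc (suc m)) (pathEccentricitySum-step m) ⟩
    4 * (M + (3 * m + 2)) + 2 * suc (suc m) ≡⟨ shift m M ⟩
    4 * M + 2 * m + (12 * m + 12)           ≤⟨ +-monoˡ-≤ (12 * m + 12) lower ⟩
    3 * (m * m) + (12 * m + 12)             ≡⟨ square m ⟨
    3 * (suc (suc m) * suc (suc m))         ∎
  upper′ : 3 * (suc (suc m) * suc (suc m)) ≤ 4 * pathEccentricitySum (suc (suc m)) + 2 * suc (suc m) + 1
  upper′ = begin
    3 * (suc (suc m) * suc (suc m))             ≡⟨ square m ⟩
    3 * (m * m) + (12 * m + 12)                 ≤⟨ +-monoˡ-≤ (12 * m + 12) upper ⟩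
    4 * M + 2 * m + 1 + (12 * m + 12)           ≡⟨ regroup (4 * M + 2 * m) (12 * m + 12) ⟩
    4 * M + 2 * m + (12 * m + 12) + 1           ≡⟨ cong (_+ 1) (shift m M) ⟨
    4 * (M + (3 * m + 2)) + 2 * suc (suc m) + 1
      ≡⟨ cong (λ x → 4 * x + 2 * suc (suc m) + 1) (pathEccentricitySum-step m) ⟨
    4 * pathEccentricitySum (suc (suc m)) + 2 * suc (suc m) + 1 ∎
    where
    regroup : ∀ x y → x + 1 + y ≡ x + y + 1
    regroup = solve-∀

arithmetic-series : ∀ n → 2 * rangeSum n (n ∸_) ≡ n * suc n
arithmetic-series zero = refl
arithmetic-series (suc n) = begin
  2 * (suc n + rangeSum n (n ∸_))   ≡⟨ *-distribˡ-+ 2 (suc n) (rangeSum n (n ∸_)) ⟩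
  2 * suc n + 2 * rangeSum n (n ∸_) ≡⟨ cong (2 * suc n +_) (arithmetic-series n) ⟩
  2 * suc n + n * suc n             ≡⟨ *-distribʳ-+ (suc n) 2 n ⟨
  suc (suc n) * suc n               ≡⟨ *-comm (suc (suc n)) (suc n) ⟩
  suc n * suc (suc n)               ∎
  where open ≡-Reasoning

∑-distance-bound : ∀ n v → v < n → 2 * rangeSum n (λ u → ∣ v - u ∣) ≤ n * pred n
∑-distance-bound (suc n) v v<1+n = begin
  2 * rangeSum (suc n) ∣v-_∣         ≡⟨ cong (2 *_) (rangeSum-snoc n ∣v-_∣) ⟩
  2 * (rangeSum n ∣v-_∣ + ∣ v - n ∣) ≡⟨ *-distribˡ-+ 2 (rangeSum n ∣v-_∣) ∣ v - n ∣ ⟩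
  2 * rangeSum n ∣v-_∣ + 2 * ∣ v - n ∣ ≤⟨ last-vertex (m<1+n⇒m<n∨m≡n v<1+n) ⟩
  suc n * n                          ∎
  where
  open ≤-Reasoning
  ∣v-_∣ : ℕ → ℕ
  ∣v- u ∣ = ∣ v - u ∣
  last-vertex : v < n ⊎ v ≡ n → 2 * rangeSum n ∣v-_∣ + 2 * ∣ v - n ∣ ≤ suc n * n
  last-vertex (inj₁ v<n@(s≤s {n = k} _)) = begin
    2 * rangeSum (suc k) ∣v-_∣ + 2 * ∣ v - suc k ∣
      ≤⟨ +-mono-≤ (∑-distance-bound (suc k) v v<n) (*-monoʳ-≤ 2 ∣v-n∣≤n) ⟩
    suc k * k + 2 * suc k                         ≡⟨ regroup k ⟩
    suc (suc k) * suc k                           ∎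
    where
    regroup : ∀ k → suc k * k + 2 * suc k ≡ suc (suc k) * suc k
    regroup = solve-∀
    ∣v-n∣≤n : ∣ v - suc k ∣ ≤ suc k
    ∣v-n∣≤n = ≤-trans (≤-reflexive (m≤n⇒∣m-n∣≡n∸m (<⇒≤ v<n))) (m∸n≤m (suc k) v)
  last-vertex (inj₂ refl) = begin
    2 * rangeSum v ∣v-_∣ + 2 * ∣ v - v ∣
      ≡⟨ cong₂ (λ x y → 2 * x + 2 * y) (rangeSum-cong v (λ u u<v → m≤n⇒∣n-m∣≡n∸m (<⇒≤ u<v))) (∣n-n∣≡0 v) ⟩
    2 * rangeSum v (v ∸_) + 0 ≡⟨ +-identityʳ _ ⟩
    2 * rangeSum v (v ∸_)     ≡⟨ arithmetic-series v ⟩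
    v * suc v                 ≡⟨ *-comm v (suc v) ⟩
    suc v * v                 ∎

module _ (m : ℕ) where
  open PathGraph (suc m)

  private
    P = pathGraph (suc m)

  pathEccentricity-≤ : ∀ v → pathEccentricity (suc m) (toℕ v) ≤ eccentricity P v
  pathEccentricity-≤ v = subst (pathEccentricity (suc m) (toℕ v) ≤_) (sym (eccentricity≡maximum P v))
    (⊔-lub (subst (_≤ maximum (dist P v)) to-first (≤-maximum (dist P v) Fin.zero))
           (subst (_≤ maximum (dist P v)) to-last (≤-maximum (dist P v) (Fin.fromℕ m))))
    where
    to-first : dist P v Fin.zero ≡ toℕ v
    to-first = trans (dist-path v Fin.zero) (∣-∣-identityʳ (toℕ v))
    to-last : dist P v (Fin.fromℕ m) ≡ m ∸ toℕ v
    to-last = trans (dist-path v (Fin.fromℕ m))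
      (trans (cong (∣ toℕ v -_∣) (Fin.toℕ-fromℕ m)) (m≤n⇒∣m-n∣≡n∸m (≤-pred (toℕ<n v))))

  pathEccentricitySum-≤ : pathEccentricitySum (suc m) ≤ eccentricitySum P
  pathEccentricitySum-≤ = subst (pathEccentricitySum (suc m) ≤_)
    (sym (foldr-map-allFin _+_ 0 (eccentricity P))) (∑-mono-≤ pathEccentricity-≤)

  path-transmission-≤ : ∀ v → 2 * transmission P v ≤ suc m * m
  path-transmission-≤ v = subst (λ t → 2 * t ≤ suc m * m)
    (sym (trans (transmission≡sum P v) (sum-cong-≗ (dist-path v))))
    (∑-distance-bound (suc m) (toℕ v) (toℕ<n v))

  path-maxTransmission-≤ : 2 * maxTransmission P ≤ suc m * m
  path-maxTransmission-≤ with maximum-attained (transmission P)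
  ... | v , max≡ = subst (λ t → 2 * t ≤ suc m * m)
    (sym (trans (foldr-map-allFin _⊔_ 0 (transmission P)) max≡)) (path-transmission-≤ v)

on-geodesic-arith : ∀ m D x y → D ≤ suc m → x + y ≡ D →
  2 * suc m * (x ⊔ y) + suc (suc m) * suc m ≡
  suc (suc m) * (x + y) + (2 * suc m * (x ⊔ (D ∸ x)) + suc (suc m) * (suc m ∸ D))
on-geodesic-arith m D x y D≤ x+y≡D = begin
  2 * suc m * (x ⊔ y) + N * suc m     ≡⟨ cong (λ z → 2 * suc m * (x ⊔ z) + N * suc m) y≡D∸x ⟩
  e + N * suc m                       ≡⟨ cong (λ z → e + N * z) (m+[n∸m]≡n D≤) ⟨
  e + N * (D + (suc m ∸ D))           ≡⟨ regroup e N D (suc m ∸ D) ⟩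
  N * D + (e + N * (suc m ∸ D))       ≡⟨ cong (λ z → N * z + (e + N * (suc m ∸ D))) x+y≡D ⟨
  N * (x + y) + (e + N * (suc m ∸ D)) ∎
  where
  open ≡-Reasoning
  N e : ℕ
  N = suc (suc m)
  e = 2 * suc m * (x ⊔ (D ∸ x))
  y≡D∸x : y ≡ D ∸ x
  y≡D∸x = sym (trans (cong (_∸ x) (sym x+y≡D)) (m+n∸m≡n x y))
  regroup : ∀ e N D r → e + N * (D + r) ≡ N * D + (e + N * r)
  regroup = solve-∀

farther-end-arith : ∀ m D x y → x ≤ D → suc D ≤ x + y →
  2 * suc m * x + suc (suc m) * suc m ≤ suc (suc m) * (x + y) + m * (D + suc (suc m))
farther-end-arith m D x y x≤D D<x+y with m≤n⇒∃[o]m+o≡n x≤D | m≤n⇒∃[o]m+o≡n D<x+y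
... | e₂ , refl | e₁ , 1+D+e₁≡x+y = begin
  2 * suc m * x + N * suc m                    ≤⟨ m≤m+n _ slack ⟩
  2 * suc m * x + N * suc m + slack            ≡⟨ expand m x e₁ e₂ ⟩
  N * (x + (e₂ + 1 + e₁)) + m * ((x + e₂) + N) ≡⟨ cong (λ z → N * (x + z) + m * ((x + e₂) + N)) y≡ ⟨
  N * (x + y) + m * ((x + e₂) + N)             ∎
  where
  open ≤-Reasoning
  N slack : ℕ
  N = suc (suc m)
  slack = 2 * e₂ + 2 * e₂ * m + 2 * e₁ + e₁ * m
  expand : ∀ m x e₁ e₂ →
    2 * suc m * x + suc (suc m) * suc m + (2 * e₂ + 2 * e₂ * m + 2 * e₁ + e₁ * m) ≡
    suc (suc m) * (x + (e₂ + 1 + e₁)) + m * ((x + e₂) + suc (suc m))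
  expand = solve-∀
  regroup : ∀ x e₁ e₂ → suc (x + e₂) + e₁ ≡ x + (e₂ + 1 + e₁)
  regroup = solve-∀
  y≡ : y ≡ e₂ + 1 + e₁
  y≡ = +-cancelˡ-≡ x _ _ (trans (sym 1+D+e₁≡x+y) (regroup x e₁ e₂))

off-geodesic-arith : ∀ m D x y → x ≤ D → y ≤ D → suc D ≤ x + y →
  2 * suc m * (x ⊔ y) + suc (suc m) * suc m ≤ suc (suc m) * (x + y) + m * (D + suc (suc m))
off-geodesic-arith m D x y x≤D y≤D D<x+y with ⊔-sel x y
... | inj₁ x⊔y≡x rewrite x⊔y≡x = farther-end-arith m D x y x≤D D<x+y
... | inj₂ x⊔y≡y rewrite x⊔y≡y | +-comm x y = farther-end-arith m D y x y≤D D<x+y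

-- The case of s + 1 vertices off a diametral path of a tree on N = D + s + 2 vertices,
-- after bounding pathEccentricitySum from both sides by 3m² - 2m.
off-geodesic-count-arith : ∀ D s A B →
  4 * A + 2 * suc D ≤ 3 * (suc D * suc D) →
  3 * (suc (suc (D + s)) * suc (suc (D + s))) ≤ 4 * B + 2 * suc (suc (D + s)) + 1 →
  2 * suc (D + s) * A + suc D * (suc (suc (D + s)) * suc s) + (D + s) * (D + suc (suc (D + s))) * suc s ≤
  2 * suc (D + s) * B
off-geodesic-count-arith D s A B lower upper =
  *-cancelˡ-≤ 2 (+-cancelʳ-≤ K _ _ (begin
    2 * LHS + K                             ≡⟨ expand₁ D s A ⟩
    n₁ * (4 * A + 2 * suc D) + X            ≤⟨ +-monoˡ-≤ X (*-monoʳ-≤ n₁ lower) ⟩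
    n₁ * (3 * (suc D * suc D)) + X          ≤⟨ m≤m+n _ slack ⟩
    n₁ * (3 * (suc D * suc D)) + X + slack  ≡⟨ expand₂ D s ⟩
    n₁ * (3 * (N * N)) + n₁ * (2 * suc D)   ≤⟨ +-monoˡ-≤ _ (*-monoʳ-≤ n₁ upper) ⟩
    n₁ * (4 * B + 2 * N + 1) + n₁ * (2 * suc D) ≡⟨ expand₃ D s B ⟩
    2 * (2 * n₁ * B) + K                    ∎))
  where
  open ≤-Reasoning
  N n₁ LHS K X slack : ℕ
  N = suc (suc (D + s))
  n₁ = suc (D + s)
  LHS = 2 * n₁ * A + suc D * (N * suc s) + (D + s) * (D + N) * suc s
  K = n₁ * (2 * suc D) + n₁ * (2 * N + 1)
  X = 2 * (suc D * (N * suc s) + (D + s) * (D + N) * suc s) + n₁ * (2 * N + 1)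
  slack = 2 + 2 * D + 6 * s + 4 * s * D + 5 * s * s + s * s * D + s * s * s
  expand₁ : ∀ D s A →
    2 * (2 * suc (D + s) * A + suc D * (suc (suc (D + s)) * suc s) + (D + s) * (D + suc (suc (D + s))) * suc s)
      + (suc (D + s) * (2 * suc D) + suc (D + s) * (2 * suc (suc (D + s)) + 1))
    ≡ suc (D + s) * (4 * A + 2 * suc D)
      + (2 * (suc D * (suc (suc (D + s)) * suc s) + (D + s) * (D + suc (suc (D + s))) * suc s)
         + suc (D + s) * (2 * suc (suc (D + s)) + 1))
  expand₁ = solve-∀
  expand₂ : ∀ D s →
    suc (D + s) * (3 * (suc D * suc D))
      + (2 * (suc D * (suc (suc (D + s)) * suc s) + (D + s) * (D + suc (suc (D + s))) * suc s)
         + suc (D + s) * (2 * suc (suc (D + s)) + 1))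
      + (2 + 2 * D + 6 * s + 4 * s * D + 5 * s * s + s * s * D + s * s * s)
    ≡ suc (D + s) * (3 * (suc (suc (D + s)) * suc (suc (D + s)))) + suc (D + s) * (2 * suc D)
  expand₂ = solve-∀
  expand₃ : ∀ D s B →
    suc (D + s) * (4 * B + 2 * suc (suc (D + s)) + 1) + suc (D + s) * (2 * suc D)
    ≡ 2 * (2 * suc (D + s) * B) + (suc (D + s) * (2 * suc D) + suc (D + s) * (2 * suc (suc (D + s)) + 1))
  expand₃ = solve-∀

geodesic-count-arith : ∀ m D → D ≤ suc m →
  2 * suc m * pathEccentricitySum (suc D) + suc D * (suc (suc m) * (suc m ∸ D))
    + m * (D + suc (suc m)) * (suc (suc m) ∸ suc D)
  ≤ 2 * suc m * pathEccentricitySum (suc (suc m))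
geodesic-count-arith m D D≤1+m with m≤n⇒m<n∨m≡n D≤1+m
... | inj₂ refl
  rewrite n∸n≡0 m | *-zeroʳ (suc (suc m)) | *-zeroʳ (suc m) | *-zeroʳ (m * (suc m + suc (suc m))) =
  ≤-reflexive (trans (+-identityʳ _) (+-identityʳ _))
... | inj₁ (s≤s D≤m) with m≤n⇒∃[o]m+o≡n D≤m
...   | s , refl rewrite +-∸-assoc 1 (m≤m+n D s) | m+n∸m≡n D s =
  off-geodesic-count-arith D s _ _ (proj₁ (pathEccentricitySum-bounds (suc D)))
                                   (proj₂ (pathEccentricitySum-bounds (suc (suc (D + s)))))

module DiametralCount {m} {G : Graph (suc (suc m))} (tree : IsTree G)
                      (a b : Fin (suc (suc m))) (diametral : ∀ x y → dist G x y ≤ dist G a b) where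
  open RootedTree tree a
  open Diametral b diametral

  private
    N D : ℕ
    N = suc (suc m)
    D = depth b

  D≤1+m : D ≤ suc m
  D≤1+m = ≤-pred (d-< a b)

  γ : Fin (suc D) → Fin N
  γ k = ancestor b (toℕ k)

  depth-γ : ∀ k → depth (γ k) ≡ toℕ k
  depth-γ k = depth-ancestor (≤-pred (toℕ<n k))

  onGeodesic : Fin N → ℕ
  onGeodesic v = ∑[ k < suc D ] δ v (γ k)

  onGeodesic-≤1 : ∀ v → onGeodesic v ≤ 1
  onGeodesic-≤1 = ∑-δ-injective γ (λ {i} {j} γi≡γj →
    toℕ-injective (trans (sym (depth-γ i)) (trans (cong depth γi≡γj) (depth-γ j))))

  off-geodesic-count : ∑[ v < N ] (1 ∸ onGeodesic v) ≡ N ∸ suc D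
  off-geodesic-count = trans (sym (m+n∸n≡m _ (suc D))) (cong (_∸ suc D) (begin
    (∑[ v < N ] (1 ∸ onGeodesic v)) + suc D
      ≡⟨ cong ((∑[ v < N ] (1 ∸ onGeodesic v)) +_) on-count ⟨
    (∑[ v < N ] (1 ∸ onGeodesic v)) + (∑[ v < N ] onGeodesic v)
      ≡⟨ ∑-distrib-+ (λ v → 1 ∸ onGeodesic v) onGeodesic ⟨
    ∑[ v < N ] ((1 ∸ onGeodesic v) + onGeodesic v)
      ≡⟨ sum-cong-≗ (λ v → m∸n+n≡m (onGeodesic-≤1 v)) ⟩
    ∑[ v < N ] 1
      ≡⟨ trans (∑-const N 1) (*-identityʳ N) ⟩
    N ∎))
    where
    open ≡-Reasoning
    on-count : ∑[ v < N ] onGeodesic v ≡ suc D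
    on-count = trans (∑-comm (λ v k → δ v (γ k)))
      (trans (sum-cong-≗ (λ k → ∑-δ (γ k))) (trans (∑-const (suc D) 1) (*-identityʳ (suc D))))

  -- What each vertex contributes beyond N times its distance sum to the two ends.
  onExcess : ℕ → ℕ
  onExcess k = 2 * suc m * (k ⊔ (D ∸ k)) + N * (suc m ∸ D)

  offExcess : ℕ
  offExcess = m * (D + N)

  geodesicExcess : Fin N → ℕ
  geodesicExcess v = ∑[ k < suc D ] (onExcess (toℕ k) * δ v (γ k))

  excess : Fin N → ℕ
  excess v = geodesicExcess v + offExcess * (1 ∸ onGeodesic v)

  eccentricity-≤ : ∀ v →
    2 * suc m * eccentricity G v + N * suc m ≤ 2 * suc m * (depth v ⊔ d v b) + N * suc m
  eccentricity-≤ v = +-monoˡ-≤ (N * suc m) (*-monoʳ-≤ (2 * suc m)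
    (subst (_≤ depth v ⊔ d v b) (sym (eccentricity≡maximum G v)) (maximum-≤ (d-≤-⊔ v))))

  vertex-bound : ∀ v → 2 * suc m * eccentricity G v + N * suc m ≤ N * (depth v + d v b) + excess v
  vertex-bound v with depth v + d v b ≟ D
  ... | yes on = begin
    2 * suc m * eccentricity G v + N * suc m   ≤⟨ eccentricity-≤ v ⟩
    2 * suc m * (depth v ⊔ d v b) + N * suc m  ≡⟨ on-geodesic-arith m D (depth v) (d v b) D≤1+m on ⟩
    N * (depth v + d v b) + onExcess (depth v)
      ≤⟨ +-monoʳ-≤ (N * (depth v + d v b)) (≤-trans geodesic-term (m≤m+n _ _)) ⟩
    N * (depth v + d v b) + excess v           ∎
    where
    open ≤-Reasoning
    depth<1+D : depth v < suc D
    depth<1+D = s≤s (subst (depth v ≤_) on (m≤m+n _ _))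
    at-depth : ∀ k → toℕ k ≡ depth v → onExcess (toℕ k) * δ v (γ k) ≡ onExcess (depth v)
    at-depth k k≡depth = begin-equality
      onExcess (toℕ k) * δ v (ancestor b (toℕ k))
        ≡⟨ cong (λ i → onExcess i * δ v (ancestor b i)) k≡depth ⟩
      onExcess (depth v) * δ v (ancestor b (depth v))
        ≡⟨ cong (λ x → onExcess (depth v) * δ v x) (geodesic-vertex v on) ⟨
      onExcess (depth v) * δ v v ≡⟨ cong (onExcess (depth v) *_) (δ-refl v) ⟩
      onExcess (depth v) * 1     ≡⟨ *-identityʳ _ ⟩
      onExcess (depth v)         ∎
    geodesic-term : onExcess (depth v) ≤ geodesicExcess v
    geodesic-term = subst (_≤ geodesicExcess v)
      (at-depth (fromℕ< depth<1+D) (toℕ-fromℕ< depth<1+D))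
      (term-≤-∑ (λ k → onExcess (toℕ k) * δ v (γ k)) (fromℕ< depth<1+D))
  ... | no off = begin
    2 * suc m * eccentricity G v + N * suc m   ≤⟨ eccentricity-≤ v ⟩
    2 * suc m * (depth v ⊔ d v b) + N * suc m
      ≤⟨ off-geodesic-arith m D (depth v) (d v b) (diametral a v) (diametral v b) D<s ⟩
    N * (depth v + d v b) + offExcess          ≤⟨ +-monoʳ-≤ (N * (depth v + d v b)) off-term ⟩
    N * (depth v + d v b) + excess v           ∎
    where
    open ≤-Reasoning
    D<s : suc D ≤ depth v + d v b
    D<s = ≤∧≢⇒< (d-triangle a v b) (off ∘ sym)
    not-on : onGeodesic v ≡ 0
    not-on = ∑-zero (λ k → δ-≢ (λ v≡γk →
      off (trans (cong (λ x → depth x + d x b) v≡γk) (depth+d-ancestor (≤-pred (toℕ<n k))))))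
    off-term : offExcess ≤ excess v
    off-term = ≤-trans (≤-reflexive (sym (trans (cong (λ z → offExcess * (1 ∸ z)) not-on) (*-identityʳ _))))
                       (m≤n+m _ _)

  excess-sum : ∑[ v < N ] excess v ≤ 2 * suc m * pathEccentricitySum N
  excess-sum = begin
    ∑[ v < N ] excess v
      ≡⟨ ∑-distrib-+ {N} geodesicExcess (λ v → offExcess * (1 ∸ onGeodesic v)) ⟩
    (∑[ v < N ] geodesicExcess v) + (∑[ v < N ] (offExcess * (1 ∸ onGeodesic v)))
      ≡⟨ cong₂ _+_ geodesic-part off-part ⟩
    2 * suc m * pathEccentricitySum (suc D) + suc D * (N * (suc m ∸ D)) + offExcess * (N ∸ suc D)
      ≤⟨ geodesic-count-arith m D D≤1+m ⟩
    2 * suc m * pathEccentricitySum N ∎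
    where
    open ≤-Reasoning
    each-once : ∀ k → ∑[ v < N ] (onExcess (toℕ k) * δ v (γ k)) ≡ onExcess (toℕ k)
    each-once k = trans (sym (*-distribˡ-sum {N} (onExcess (toℕ k)) (λ v → δ v (γ k))))
                        (trans (cong (onExcess (toℕ k) *_) (∑-δ (γ k))) (*-identityʳ _))
    geodesic-part : ∑[ v < N ] geodesicExcess v ≡
                    2 * suc m * pathEccentricitySum (suc D) + suc D * (N * (suc m ∸ D))
    geodesic-part = begin-equality
      ∑[ v < N ] ∑[ k < suc D ] (onExcess (toℕ k) * δ v (γ k))
        ≡⟨ ∑-comm (λ v k → onExcess (toℕ k) * δ v (γ k)) ⟩
      ∑[ k < suc D ] ∑[ v < N ] (onExcess (toℕ k) * δ v (γ k))
        ≡⟨ sum-cong-≗ each-once ⟩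
      ∑[ k < suc D ] onExcess (toℕ k)
        ≡⟨ ∑-distrib-+ {suc D} (λ k → 2 * suc m * e (toℕ k)) (λ _ → N * (suc m ∸ D)) ⟩
      (∑[ k < suc D ] (2 * suc m * e (toℕ k))) + (∑[ k < suc D ] (N * (suc m ∸ D)))
        ≡⟨ cong₂ _+_ (sym (*-distribˡ-sum {suc D} (2 * suc m) (e ∘ toℕ)))
                     (∑-const (suc D) (N * (suc m ∸ D))) ⟩
      2 * suc m * pathEccentricitySum (suc D) + suc D * (N * (suc m ∸ D)) ∎
      where
      e = pathEccentricity (suc D)
    off-part : ∑[ v < N ] (offExcess * (1 ∸ onGeodesic v)) ≡ offExcess * (N ∸ suc D)
    off-part = trans (sym (*-distribˡ-sum {N} offExcess (λ v → 1 ∸ onGeodesic v)))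
                     (cong (offExcess *_) off-geodesic-count)

  distance-sum-≤ : ∑[ v < N ] (depth v + d v b) ≤ 2 * maxTransmission G
  distance-sum-≤ = begin
    ∑[ v < N ] (depth v + d v b)            ≡⟨ ∑-distrib-+ {N} depth (λ v → d v b) ⟩
    (∑[ v < N ] d a v) + (∑[ v < N ] d v b) ≡⟨ cong ((∑[ v < N ] d a v) +_) (sum-cong-≗ (λ v → d-sym v b)) ⟩
    (∑[ v < N ] d a v) + (∑[ v < N ] d b v) ≤⟨ +-mono-≤ (≤-maxTransmission a) (≤-maxTransmission b) ⟩
    maxTransmission G + maxTransmission G   ≡⟨ cong (maxTransmission G +_) (+-identityʳ _) ⟨
    2 * maxTransmission G                   ∎
    where
    open ≤-Reasoning
    ≤-maxTransmission : ∀ x → ∑[ v < N ] d x v ≤ maxTransmission G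
    ≤-maxTransmission x = subst₂ _≤_ (transmission≡sum G x)
      (sym (foldr-map-allFin _⊔_ 0 (transmission G))) (≤-maximum (transmission G) x)

  eccentricitySum-bound : 2 * suc m * eccentricitySum G + N * (N * suc m) ≤
                          2 * suc m * pathEccentricitySum N + N * (2 * maxTransmission G)
  eccentricitySum-bound = begin
    2 * suc m * eccentricitySum G + N * (N * suc m)
      ≡⟨ as-sum ⟨
    ∑[ v < N ] (2 * suc m * eccentricity G v + N * suc m)
      ≤⟨ ∑-mono-≤ vertex-bound ⟩
    ∑[ v < N ] (N * (depth v + d v b) + excess v)
      ≡⟨ ∑-distrib-+ {N} (λ v → N * (depth v + d v b)) excess ⟩
    (∑[ v < N ] (N * (depth v + d v b))) + (∑[ v < N ] excess v)
      ≡⟨ cong (_+ (∑[ v < N ] excess v)) (*-distribˡ-sum {N} N (λ v → depth v + d v b)) ⟨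
    N * (∑[ v < N ] (depth v + d v b)) + (∑[ v < N ] excess v)
      ≤⟨ +-mono-≤ (*-monoʳ-≤ N distance-sum-≤) excess-sum ⟩
    N * (2 * maxTransmission G) + 2 * suc m * pathEccentricitySum N
      ≡⟨ +-comm (N * (2 * maxTransmission G)) (2 * suc m * pathEccentricitySum N) ⟩
    2 * suc m * pathEccentricitySum N + N * (2 * maxTransmission G) ∎
    where
    open ≤-Reasoning
    as-sum : ∑[ v < N ] (2 * suc m * eccentricity G v + N * suc m) ≡
             2 * suc m * eccentricitySum G + N * (N * suc m)
    as-sum = trans (∑-distrib-+ {N} (λ v → 2 * suc m * eccentricity G v) (λ _ → N * suc m))
      (cong₂ _+_ (trans (sym (*-distribˡ-sum {N} (2 * suc m) (eccentricity G)))
                        (cong (2 * suc m *_) (sym (foldr-map-allFin _+_ 0 (eccentricity G)))))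
                 (∑-const N (N * suc m)))

-- Clearing denominators

ℤ-difference-≤ : ∀ p q r s → p ℤ.+ s ℤ.≤ r ℤ.+ q → p ℤ.- q ℤ.≤ r ℤ.- s
ℤ-difference-≤ p q r s p+s≤r+q =
  subst₂ ℤ._≤_ (cancel p s q) (trans (cong (ℤ._-_ (r ℤ.+ q)) (ℤ.+-comm q s)) (cancel r q s))
    (ℤ.+-monoˡ-≤ (ℤ.- (q ℤ.+ s)) p+s≤r+q)
  where
  cancel : ∀ x y z → (x ℤ.+ y) ℤ.- (z ℤ.+ y) ≡ x ℤ.- z
  cancel = ℤ-solve-∀

ℚᵘ-difference-≤ : ∀ a c e f k₁ k₂ → a * suc k₂ + f * suc k₁ ≤ e * suc k₂ + c * suc k₁ →
  ℚᵘ.mkℚᵘ (ℤ.+ a) k₁ ℚᵘ.- ℚᵘ.mkℚᵘ (ℤ.+ c) k₂ ℚᵘ.≤ ℚᵘ.mkℚᵘ (ℤ.+ e) k₁ ℚᵘ.- ℚᵘ.mkℚᵘ (ℤ.+ f) k₂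
ℚᵘ-difference-≤ a c e f k₁ k₂ cleared =
  ℚᵘ.*≤* (ℤ.*-monoʳ-≤-nonNeg (ℚᵘ.↧ (ℚᵘ.mkℚᵘ (ℤ.+ e) k₁ ℚᵘ.- ℚᵘ.mkℚᵘ (ℤ.+ f) k₂))
    (subst₂ ℤ._≤_ (sym (numerator a c)) (sym (numerator e f))
      (ℤ-difference-≤ (scaled a k₂) (scaled c k₁) (scaled e k₂) (scaled f k₁)
        (subst₂ ℤ._≤_ (as-ℤ a f) (as-ℤ e c) (ℤ.+≤+ cleared)))))
  where
  scaled : ℕ → ℕ → ℤ.ℤ
  scaled x k = (ℤ.+ x) ℤ.* (ℤ.+ suc k)
  numerator : ∀ x y → scaled x k₂ ℤ.+ (ℤ.- (ℤ.+ y)) ℤ.* (ℤ.+ suc k₁) ≡ scaled x k₂ ℤ.- scaled y k₁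
  numerator x y = cong (ℤ._+_ (scaled x k₂)) (sym (ℤ.neg-distribˡ-* (ℤ.+ y) (ℤ.+ suc k₁)))
  as-ℤ : ∀ x y → ℤ.+ (x * suc k₂ + y * suc k₁) ≡ scaled x k₂ ℤ.+ scaled y k₁
  as-ℤ x y = trans (ℤ.pos-+ (x * suc k₂) _) (cong₂ ℤ._+_ (ℤ.pos-* x (suc k₂)) (ℤ.pos-* y (suc k₁)))

fraction-difference-≤ : ∀ a c e f k₁ k₂ → a * suc k₂ + f * suc k₁ ≤ e * suc k₂ + c * suc k₁ →
  ((ℤ.+ a) / suc k₁) - ((ℤ.+ c) / suc k₂) ≤ℚ ((ℤ.+ e) / suc k₁) - ((ℤ.+ f) / suc k₂)
fraction-difference-≤ a c e f k₁ k₂ cleared =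
  ℚ.toℚᵘ-cancel-≤ (ℚᵘ.≤-respˡ-≃ (ℚᵘ.≃-sym (as-ℚᵘ a c)) (ℚᵘ.≤-respʳ-≃ (ℚᵘ.≃-sym (as-ℚᵘ e f))
    (ℚᵘ-difference-≤ a c e f k₁ k₂ cleared)))
  where
  toℚᵘ-/ : ∀ x k → ℚ.toℚᵘ ((ℤ.+ x) / suc k) ℚᵘ.≃ ℚᵘ.mkℚᵘ (ℤ.+ x) k
  toℚᵘ-/ x k = ℚ.toℚᵘ-fromℚᵘ (ℚᵘ.mkℚᵘ (ℤ.+ x) k)
  as-ℚᵘ : ∀ x y → ℚ.toℚᵘ (((ℤ.+ x) / suc k₁) - ((ℤ.+ y) / suc k₂)) ℚᵘ.≃
                  ℚᵘ.mkℚᵘ (ℤ.+ x) k₁ ℚᵘ.- ℚᵘ.mkℚᵘ (ℤ.+ y) k₂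
  as-ℚᵘ x y = ℚᵘ.≃-trans (ℚ.toℚᵘ-homo-+ ((ℤ.+ x) / suc k₁) (ℚ.- ((ℤ.+ y) / suc k₂)))
    (ℚᵘ.+-cong (toℚᵘ-/ x k₁) (ℚᵘ.≃-trans (ℚ.toℚᵘ-homo‿- ((ℤ.+ y) / suc k₂)) (ℚᵘ.-‿cong (toℚᵘ-/ y k₂))))

clear-denominators : ∀ m E R M Eₚ Rₚ →
  2 * suc m * E + suc (suc m) * (suc (suc m) * suc m) ≤ 2 * suc m * M + suc (suc m) * (2 * R) →
  M ≤ Eₚ → 2 * Rₚ ≤ suc (suc m) * suc m →
  E * suc m + Rₚ * suc (suc m) ≤ Eₚ * suc m + R * suc (suc m)
clear-denominators m E R M Eₚ Rₚ tree-bound M≤Eₚ path-bound = *-cancelˡ-≤ 2 (begin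
  2 * (E * suc m + Rₚ * N)        ≡⟨ double m E Rₚ ⟩
  2 * suc m * E + N * (2 * Rₚ)    ≤⟨ +-monoʳ-≤ (2 * suc m * E) (*-monoʳ-≤ N path-bound) ⟩
  2 * suc m * E + N * (N * suc m) ≤⟨ tree-bound ⟩
  2 * suc m * M + N * (2 * R)     ≤⟨ +-monoˡ-≤ (N * (2 * R)) (*-monoʳ-≤ (2 * suc m) M≤Eₚ) ⟩
  2 * suc m * Eₚ + N * (2 * R)    ≡⟨ double m Eₚ R ⟨
  2 * (Eₚ * suc m + R * N)        ∎)
  where
  open ≤-Reasoning
  N = suc (suc m)
  double : ∀ m x y → 2 * (x * suc m + y * suc (suc m)) ≡ 2 * suc m * x + suc (suc m) * (2 * y)
  double = solve-∀

ecc-remoteness-≤-path : ∀ m (G : Graph (suc (suc m))) → IsTree G →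
  (ecc G - remoteness G) ≤ℚ (ecc (pathGraph (suc (suc m))) - remoteness (pathGraph (suc (suc m))))
ecc-remoteness-≤-path m G tree = from-diametral-pair (maximum-attained₂ (dist G))
  where
  P = pathGraph (suc (suc m))
  from-diametral-pair : (∃[ a ] ∃[ b ] ∀ x y → dist G x y ≤ dist G a b) →
    (ecc G - remoteness G) ≤ℚ (ecc P - remoteness P)
  from-diametral-pair (a , b , diametral) =
    fraction-difference-≤ E R Eₚ Rₚ (suc m) m
      (clear-denominators m E R (pathEccentricitySum (suc (suc m))) Eₚ Rₚ
         (DiametralCount.eccentricitySum-bound tree a b diametral)
         (pathEccentricitySum-≤ (suc m)) (path-maxTransmission-≤ (suc m)))
    where
    E R Eₚ Rₚ : ℕ
    E = eccentricitySum G
    R = maxTransmission G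
    Eₚ = eccentricitySum P
    Rₚ = maxTransmission P

theorem12 : (n : ℕ) → 3 ≤ n → (G : Graph n) → IsTree G →
    (ecc G - remoteness G) ≤ℚ (ecc (pathGraph n) - remoteness (pathGraph n))
theorem12 (suc (suc m)) _ G tree = ecc-remoteness-≤-path m G tree
theorem12 (suc zero) (s≤s ())
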